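{- Let $\mathcal{T}$ be an $r$-tree with vertex set $V$ and let $\succ$ be any total order on $V$. Then every directed cycle of the toppled digraph of $(\mathcal{T},\succ)$ has length a multiple of $r$.
   Context: An $r$-tree is a connected $r$-uniform hypergraph (edges are $r$-subsets of $V$) with no cycles, where a cycle of length $s\ge2$ is $v_1e_1\cdots v_se_sv_1$ with distinct vertices, distinct edges, $v_i,v_{i+1}\in e_i$. Let $|V|=n+1$ and $d=(r-2)(n+1)+1$. A configuration is a function $\alpha:V\to\mathbb{Z}_{\ge0}$ with $\sum_v\alpha(v)=d$. For $v\in V$ let $S_v$ be the set of configurations with $\alpha(v)\ge r-1$ and $\alpha(w)<r-1$ for all $w\succ v$. Toppling the incidence $(v,e)$ ($v\in e\in E$) transforms $\alpha$ into $\alpha'$ with $\alpha'(v)=\alpha(v)-(r-1)$, $\alpha'(w)=\alpha(w)+1$ for $w\in e\setminus\{v\}$, unchanged elsewhere; it is allowed only if $\alpha\in S_v$. The toppled digraph has the configurations as vertices and an arc $\alpha\to\alpha'$ whenever $\alpha'$ arises from $\alpha$ by an allowed toppling. -}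

module Defs where

open import Data.Nat using (ℕ; zero; suc; _+_; _*_; _∸_; _≤_; _<_)
open import Data.Nat.DivMod using (_mod_)
open import Data.Fin using (Fin; toℕ; _≟_)
open import Data.Fin.Subset using (Subset; _∈_; ∣_∣)
open import Data.Vec using (lookup; tabulate; sum)
open import Data.Bool using (if_then_else_)
open import Data.Integer as ℤ using (ℤ; +_)
open import Data.Product using (Σ; _×_; ∃; ∃-syntax)
open import Relation.Nullary using (¬_; does)
open import Relation.Binary.PropositionalEquality using (_≡_)
open import Relation.Binary.Construct.Closure.ReflexiveTransitive using (Star)

next : ∀ {k} → Fin (suc k) → Fin (suc k)
next {k} i = suc (toℕ i) mod suc k

-- An r-uniform hypergraph on vertex set V = Fin (suc n) (so |V| = n+1)
-- with m edges E 0, …, E (m-1): distinct edges, each an r-subset of V.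
IsUniformHypergraph : (r n m : ℕ) → (Fin m → Subset (suc n)) → Set
IsUniformHypergraph r n m E =
  (∀ j → ∣ E j ∣ ≡ r) × (∀ i j → E i ≡ E j → i ≡ j)

Adjacent : ∀ {n m} → (Fin m → Subset (suc n)) → Fin (suc n) → Fin (suc n) → Set
Adjacent E v w = ∃[ j ] (v ∈ E j × w ∈ E j)

Connected : ∀ {n m} → (Fin m → Subset (suc n)) → Set
Connected E = ∀ v w → Star (Adjacent E) v w

-- A cycle of length s = k+1 ≥ 2: v₀ e₀ v₁ e₁ ⋯ v_{s-1} e_{s-1} v₀ with distinct
-- vertices, distinct edges, and vᵢ, vᵢ₊₁ ∈ eᵢ (indices mod s).
HCycle : ∀ {n m} → (Fin m → Subset (suc n)) → Set
HCycle {n} {m} E =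
  Σ ℕ λ k → (1 ≤ k) ×
  (Σ (Fin (suc k) → Fin (suc n)) λ v →
   Σ (Fin (suc k) → Fin m) λ e →
     (∀ i j → v i ≡ v j → i ≡ j) ×
     (∀ i j → e i ≡ e j → i ≡ j) ×
     (∀ i → (v i ∈ E (e i)) × (v (next i) ∈ E (e i))))

IsTree : (r n m : ℕ) → (Fin m → Subset (suc n)) → Set
IsTree r n m E = IsUniformHypergraph r n m E × Connected E × ¬ HCycle E

-- configurations: α : V → ℕ with Σ α = d = (r-2)(n+1)+1 (computed in ℤ)
IsConfig : (r n : ℕ) → (Fin (suc n) → ℕ) → Set
IsConfig r n α =
  + (sum (tabulate α)) ≡ (+ r ℤ.- + 2) ℤ.* + (suc n) ℤ.+ + 1

InS : ∀ {n} (r : ℕ) (_≻_ : Fin (suc n) → Fin (suc n) → Set) →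
      Fin (suc n) → (Fin (suc n) → ℕ) → Set
InS r _≻_ v α = (r ∸ 1 ≤ α v) × (∀ w → w ≻ v → α w < r ∸ 1)

topple : ∀ {n} (r : ℕ) → (Fin (suc n) → ℕ) → Fin (suc n) → Subset (suc n) →
         Fin (suc n) → ℕ
topple r α v e w =
  if does (w ≟ v) then α v ∸ (r ∸ 1)
  else (if lookup e w then suc (α w) else α w)

Arc : ∀ {n m} (r : ℕ) (E : Fin m → Subset (suc n))
      (_≻_ : Fin (suc n) → Fin (suc n) → Set) →
      (Fin (suc n) → ℕ) → (Fin (suc n) → ℕ) → Set
Arc {n} r E _≻_ α α' =
  IsConfig r n α × IsConfig r n α' ×
  ∃[ v ] ∃[ j ] (v ∈ E j × InS r _≻_ v α × (∀ w → α' w ≡ topple r α v (E j) w))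

-- a directed cycle of length k+1 in the toppled digraph: distinct configurations
-- c 0, …, c k with arcs c i → c (i+1 mod k+1)
DirectedCycle : ∀ {n m} (r : ℕ) (E : Fin m → Subset (suc n))
                (_≻_ : Fin (suc n) → Fin (suc n) → Set) → ℕ → Set
DirectedCycle {n} r E _≻_ k =
  Σ (Fin (suc k) → Fin (suc n) → ℕ) λ c →
    (∀ i j → (∀ w → c i w ≡ c j w) → i ≡ j) ×
    (∀ i → Arc r E _≻_ (c i) (c (next i)))

-- Toppling (v, e) changes the potential Σ_w α(w) f(w) of a configuration by
-- Σ_{w∈e} f(w) − r f(v).  So if the integer weights f give every edge a weight
-- sum ≡ 1 (mod r), each arc raises the potential by 1 mod r, and a directed cycle
-- of length L gives L ≡ 0 (mod r).  Such weights exist on every r-uniform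
-- hyperforest, by induction on the edges: having weighted all edges but e₀, add a
-- suitable constant on the component (without e₀) of a vertex u ∈ e₀.  Acyclicity
-- makes u the only vertex of e₀ in that component, so the sum over e₀ moves by
-- exactly that constant, while every other edge, of size r, lies entirely inside
-- or outside the component.
module Submission where

open import Defs
open import Data.Nat as ℕ using (ℕ; zero; suc)
open import Data.Nat.Divisibility using (_∣_)
import Data.Nat.Properties as ℕₚ
open import Data.Nat.DivMod using (_%_; m<n⇒m%n≡m; n%n≡0)
open import Data.Fin using (Fin; zero; suc; toℕ; fromℕ; inject₁; _≟_)
open import Data.Fin.Properties
  using (toℕ-injective; toℕ-fromℕ<; toℕ-inject₁; toℕ-fromℕ; toℕ<n; suc-injective;
         inject₁-injective; fromℕ≢inject₁; punchInᵢ≢i; any?)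
open import Data.Fin.Subset using (Subset; _∈_; ∣_∣; Nonempty)
open import Data.Fin.Subset.Properties using (_∈?_)
open import Data.Fin.Relation.Unary.Top using (view; ‵fromℕ; ‵inject₁)
open import Data.Vec using ([]; _∷_; lookup; here; there)
open import Data.Vec.Properties using ([]=⇒lookup; lookup⇒[]=)
open import Data.Vec.Functional as Vector using (Vector; init; last)
open import Data.Bool using (true; false; if_then_else_)
open import Data.Integer as ℤ using (ℤ; +_; -[1+_]; 0ℤ; 1ℤ; _+_; _-_; _*_; -_)
open import Data.Integer.Properties
  using (+-*-semiring; +-comm; +-identityˡ; +-identityʳ; *-zeroʳ)
open import Data.Integer.Divisibility.Signed
  using (divides; ∣-refl; ∣m∣n⇒∣m+n; ∣m∣n⇒∣m-n; ∣m⇒∣-m; ∣m⇒∣m*n; ∣⇒∣ᵤ)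
  renaming (_∣_ to _∣ℤ_)
open import Data.Integer.Tactic.RingSolver using (solve-∀)
open import Algebra.Properties.Semiring.Sum +-*-semiring
  using (sum; ∑-distrib-+; sum-remove; sum-init-last; sum-cong-≗; sum-replicate-zero)
open import Data.Product as Product using (Σ; ∃-syntax; _×_; _,_; proj₁; proj₂)
open import Data.Sum using (_⊎_; inj₁; inj₂)
open import Data.Empty using (⊥; ⊥-elim)
open import Data.Unit using (⊤; tt)
open import Function using (_∘_)
open import Relation.Nullary using (¬_; Dec; yes; no; does)
open import Relation.Nullary.Decidable using (map′; dec-true; dec-false; _×-dec_; _⊎-dec_)
open import Relation.Binary.Definitions using (Decidable)
open import Relation.Binary.Structures using (IsStrictTotalOrder)
open import Relation.Binary.PropositionalEquality
  using (_≡_; _≢_; refl; sym; trans; cong; cong₂; subst; module ≡-Reasoning)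
open import Relation.Binary.Construct.Closure.ReflexiveTransitive
  using (Star; ε; _◅_; _◅◅_; gmap; reverse)

open ≡-Reasoning

Injective : ∀ {A : Set} {N} → (Fin N → A) → Set
Injective g = ∀ i j → g i ≡ g j → i ≡ j

next-inject₁ : ∀ {k} (i : Fin k) → next (inject₁ i) ≡ suc i
next-inject₁ {k} i = toℕ-injective (begin
  toℕ (next (inject₁ i))        ≡⟨ toℕ-fromℕ< _ ⟩
  suc (toℕ (inject₁ i)) % suc k ≡⟨ cong (λ t → suc t % suc k) (toℕ-inject₁ i) ⟩
  suc (toℕ i) % suc k           ≡⟨ m<n⇒m%n≡m (ℕ.s≤s (toℕ<n i)) ⟩
  suc (toℕ i)                   ∎)

next-fromℕ : ∀ k → next (fromℕ k) ≡ zero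
next-fromℕ k = toℕ-injective (begin
  toℕ (next (fromℕ k))        ≡⟨ toℕ-fromℕ< _ ⟩
  suc (toℕ (fromℕ k)) % suc k ≡⟨ cong (λ t → suc t % suc k) (toℕ-fromℕ k) ⟩
  suc k % suc k               ≡⟨ n%n≡0 (suc k) ⟩
  0                           ∎)

rotate : ∀ {A : Set} {L} → Vector A (suc L) → Vector A (suc L)
rotate g = last g Vector.∷ init g

rotate-next : ∀ {A : Set} {L} (g : Vector A (suc L)) i → rotate g (next i) ≡ g i
rotate-next {L = L} g i with view i
... | ‵fromℕ     = cong (rotate g) (next-fromℕ L)
... | ‵inject₁ j = cong (rotate g) (next-inject₁ j)

∷-injective-fresh : ∀ {A : Set} {N} {x : A} {h : Vector A N} →
  (∀ i → h i ≢ x) → Injective h → Injective (x Vector.∷ h)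
∷-injective-fresh fresh inj zero    zero    _  = refl
∷-injective-fresh fresh inj zero    (suc j) eq = ⊥-elim (fresh j (sym eq))
∷-injective-fresh fresh inj (suc i) zero    eq = ⊥-elim (fresh i eq)
∷-injective-fresh fresh inj (suc i) (suc j) eq = cong suc (inj i j eq)

rotate-injective : ∀ {A : Set} {L} {g : Vector A (suc L)} → Injective g → Injective (rotate g)
rotate-injective inj = ∷-injective-fresh
  (λ i eq → fromℕ≢inject₁ (inj _ _ (sym eq)))
  (λ i j eq → inject₁-injective (inj _ _ eq))

sum-supportedAt : ∀ {N} (u : Fin N) (g : Fin N → ℤ) → (∀ w → w ≢ u → g w ≡ 0ℤ) → sum g ≡ g u
sum-supportedAt {suc N} u g vanish = begin
  sum g                             ≡⟨ sum-remove {i = u} g ⟩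
  g u + sum (Vector.removeAt g u)   ≡⟨ cong (_+_ (g u)) (sum-cong-≗ (λ w → vanish _ (punchInᵢ≢i u w))) ⟩
  g u + sum (Vector.replicate N 0ℤ) ≡⟨ cong (_+_ (g u)) (sum-replicate-zero N) ⟩
  g u + 0ℤ                          ≡⟨ +-identityʳ (g u) ⟩
  g u                               ∎

sum-ones : ∀ N → sum {N} (λ _ → 1ℤ) ≡ + N
sum-ones zero    = refl
sum-ones (suc N) = cong (_+_ 1ℤ) (sum-ones N)

∣-sum : ∀ {R N} (g : Fin N → ℤ) → (∀ i → R ∣ℤ g i) → R ∣ℤ sum g
∣-sum {N = zero}  g _   = divides 0ℤ refl
∣-sum {N = suc N} g R∣g = ∣m∣n⇒∣m+n (R∣g zero) (∣-sum (g ∘ suc) (R∣g ∘ suc))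

sum-∘next : ∀ {k} (g : Fin (suc k) → ℤ) → sum (g ∘ next) ≡ sum g
sum-∘next {k} g = begin
  sum (g ∘ next)                                   ≡⟨ sum-init-last (g ∘ next) ⟩
  sum (g ∘ next ∘ inject₁) + g (next (fromℕ k))     ≡⟨ cong₂ _+_ (sum-cong-≗ (cong g ∘ next-inject₁))
                                                                 (cong g (next-fromℕ k)) ⟩
  sum (g ∘ suc) + g zero                           ≡⟨ +-comm _ (g zero) ⟩
  sum g                                            ∎

sumOver : ∀ {N} → Subset N → (Fin N → ℤ) → ℤ
sumOver S f = sum (λ w → if lookup S w then f w else 0ℤ)

sumOver-+ : ∀ {N} (S : Subset N) (f g : Fin N → ℤ) →
  sumOver S (λ w → f w + g w) ≡ sumOver S f + sumOver S g
sumOver-+ {N} S f g =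
  trans (sum-cong-≗ (λ w → if-+ (lookup S w) (f w) (g w))) (∑-distrib-+ {N} _ _)
  where
    if-+ : ∀ b x y → (if b then x + y else 0ℤ) ≡ (if b then x else 0ℤ) + (if b then y else 0ℤ)
    if-+ true  _ _ = refl
    if-+ false _ _ = refl

sumOver-constantOn : ∀ {N} (S : Subset N) {g : Fin N → ℤ} {c} →
  (∀ {w} → w ∈ S → g w ≡ c) → sumOver S g ≡ c * + ∣ S ∣
sumOver-constantOn []          {c = c} _     = sym (*-zeroʳ c)
sumOver-constantOn (true ∷ S)  {g} {c} const = begin
  g zero + sumOver S (g ∘ suc) ≡⟨ cong₂ _+_ (const here) (sumOver-constantOn S (const ∘ there)) ⟩
  c + c * + ∣ S ∣              ≡⟨ distrib c (+ ∣ S ∣) ⟩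
  c * (1ℤ + + ∣ S ∣)           ∎
  where
    distrib : ∀ c s → c + c * s ≡ c * (1ℤ + s)
    distrib = solve-∀
sumOver-constantOn (false ∷ S) const =
  trans (+-identityˡ _) (sumOver-constantOn S (const ∘ there))

sumOver-supportedAt : ∀ {N} (S : Subset N) {u} (g : Fin N → ℤ) → u ∈ S →
  (∀ {w} → w ∈ S → w ≢ u → g w ≡ 0ℤ) → sumOver S g ≡ g u
sumOver-supportedAt S {u} g u∈S vanish = begin
  sumOver S g                            ≡⟨ sum-supportedAt u _ vanish′ ⟩
  (if lookup S u then g u else 0ℤ)       ≡⟨ cong (if_then g u else 0ℤ) ([]=⇒lookup u∈S) ⟩
  g u                                    ∎
  where
    vanish′ : ∀ w → w ≢ u → (if lookup S w then g w else 0ℤ) ≡ 0ℤ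
    vanish′ w w≢u with lookup S w in eq
    ... | true  = vanish (lookup⇒[]= w S eq) w≢u
    ... | false = refl

size-suc⇒Nonempty : ∀ {N} (S : Subset N) {k} → ∣ S ∣ ≡ suc k → Nonempty S
size-suc⇒Nonempty (true ∷ S)  _    = zero , here
size-suc⇒Nonempty (false ∷ S) size = Product.map suc there (size-suc⇒Nonempty S size)

cycle-length-divisible : ∀ {R k} (p : Fin (suc k) → ℤ) →
  (∀ i → R ∣ℤ p (next i) - p i - 1ℤ) → R ∣ℤ + suc k
cycle-length-divisible {R} {k} p R∣D = subst (R ∣ℤ_) total (∣m⇒∣-m (∣-sum D R∣D))
  where
    D : Fin (suc k) → ℤ
    D i = p (next i) - p i - 1ℤ

    telescope : sum p ≡ sum p + (+ suc k + sum D)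
    telescope = begin
      sum p                              ≡⟨ sum-∘next p ⟨
      sum (p ∘ next)                     ≡⟨ sum-cong-≗ (λ i → unfold (p (next i)) (p i)) ⟩
      sum (λ i → p i + (1ℤ + D i))       ≡⟨ ∑-distrib-+ p (λ i → 1ℤ + D i) ⟩
      sum p + sum (λ i → 1ℤ + D i)       ≡⟨ cong (_+_ (sum p)) (∑-distrib-+ (λ _ → 1ℤ) D) ⟩
      sum p + (sum {suc k} (λ _ → 1ℤ) + sum D)
                                         ≡⟨ cong (λ s → sum p + (s + sum D)) (sum-ones (suc k)) ⟩
      sum p + (+ suc k + sum D)          ∎
      where
        unfold : ∀ a b → a ≡ b + (1ℤ + (a - b - 1ℤ))
        unfold = solve-∀

    total : - sum D ≡ + suc k
    total = begin
      - sum D                                   ≡⟨ cancel (sum p) (sum D) ⟩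
      sum p - sum p - sum D                     ≡⟨ cong (λ s → s - sum p - sum D) telescope ⟩
      sum p + (+ suc k + sum D) - sum p - sum D ≡⟨ cancel′ (sum p) (+ suc k) (sum D) ⟩
      + suc k                                   ∎
      where
        cancel : ∀ x d → - d ≡ x - x - d
        cancel = solve-∀
        cancel′ : ∀ x l d → x + (l + d) - x - d ≡ l
        cancel′ = solve-∀

potential : ∀ {N} → (Fin N → ℤ) → (Fin N → ℕ) → ℤ
potential f α = sum (λ w → + α w * f w)

-- Stated with both sides moved, so that no integer subtraction occurs.
topple-weighted : ∀ {n r′} (f : Fin (suc n) → ℤ) (α : Fin (suc n) → ℕ) {v S} →
  v ∈ S → r′ ℕ.≤ α v → ∀ w →
  + topple (suc r′) α v S w * f w + (if does (w ≟ v) then + suc r′ * f w else 0ℤ)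
    ≡ + α w * f w + (if lookup S w then f w else 0ℤ)
topple-weighted {r′ = r′} f α {v} {S} v∈S r′≤αv w with w ≟ v
... | yes refl = begin
  + (α v ℕ.∸ r′) * f v + + suc r′ * f v  ≡⟨ collect (+ (α v ℕ.∸ r′)) (+ suc r′) (f v) ⟩
  + (α v ℕ.∸ r′ ℕ.+ suc r′) * f v        ≡⟨ cong (λ a → + a * f v) (m∸n+1+n≡1+m r′≤αv) ⟩
  (1ℤ + + α v) * f v                     ≡⟨ expand (+ α v) (f v) ⟩
  + α v * f v + f v                      ≡⟨ cong (λ b → + α v * f v + (if b then f v else 0ℤ))
                                                 ([]=⇒lookup v∈S) ⟨
  + α v * f v + (if lookup S v then f v else 0ℤ) ∎
  where
    collect : ∀ a b x → a * x + b * x ≡ (a + b) * x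
    collect = solve-∀
    expand : ∀ a x → (1ℤ + a) * x ≡ a * x + x
    expand = solve-∀
    m∸n+1+n≡1+m : ∀ {m n} → n ℕ.≤ m → m ℕ.∸ n ℕ.+ suc n ≡ suc m
    m∸n+1+n≡1+m {m} {n} n≤m = trans (ℕₚ.+-suc (m ℕ.∸ n) n) (cong suc (ℕₚ.m∸n+n≡m n≤m))
... | no _ with lookup S w
... | true  = expand (+ α w) (f w)
  where
    expand : ∀ a x → (1ℤ + a) * x + 0ℤ ≡ a * x + x
    expand = solve-∀
... | false = refl

potential-topple : ∀ {n r′} (f : Fin (suc n) → ℤ) {α α′ : Fin (suc n) → ℕ} {v S} →
  v ∈ S → r′ ℕ.≤ α v → (∀ w → α′ w ≡ topple (suc r′) α v S w) →
  potential f α′ + + suc r′ * f v ≡ potential f α + sumOver S f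
potential-topple {r′ = r′} f {α} {α′} {v} {S} v∈S r′≤αv α′≡ = begin
  potential f α′ + + suc r′ * f v   ≡⟨ cong (_+_ (potential f α′)) δ-sum ⟨
  potential f α′ + sum δ            ≡⟨ ∑-distrib-+ (λ w → + α′ w * f w) δ ⟨
  sum (λ w → + α′ w * f w + δ w)    ≡⟨ sum-cong-≗ (λ w → trans (cong (λ a → + a * f w + δ w) (α′≡ w))
                                                              (topple-weighted f α v∈S r′≤αv w)) ⟩
  sum (λ w → + α w * f w + (if lookup S w then f w else 0ℤ))
    ≡⟨ ∑-distrib-+ (λ w → + α w * f w) (λ w → if lookup S w then f w else 0ℤ) ⟩
  potential f α + sumOver S f       ∎
  where
    δ : Fin _ → ℤ
    δ w = if does (w ≟ v) then + suc r′ * f w else 0ℤ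
    δ-vanish : ∀ w → w ≢ v → δ w ≡ 0ℤ
    δ-vanish w w≢v = cong (if_then + suc r′ * f w else 0ℤ) (dec-false (w ≟ v) w≢v)
    δ-sum : sum δ ≡ + suc r′ * f v
    δ-sum = trans (sum-supportedAt v δ δ-vanish)
                  (cong (if_then + suc r′ * f v else 0ℤ) (dec-true (v ≟ v) refl))

potential-topple-increment : ∀ {n r′} {f : Fin (suc n) → ℤ} {α α′ : Fin (suc n) → ℕ} {v S} →
  + suc r′ ∣ℤ sumOver S f - 1ℤ → v ∈ S → r′ ℕ.≤ α v → (∀ w → α′ w ≡ topple (suc r′) α v S w) →
  + suc r′ ∣ℤ potential f α′ - potential f α - 1ℤ
potential-topple-increment {r′ = r′} {f} {α} {α′} {v} {S} R∣S v∈S r′≤αv α′≡ =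
  subst (+ suc r′ ∣ℤ_) (sym increment) (∣m∣n⇒∣m-n R∣S (∣m⇒∣m*n (f v) ∣-refl))
  where
    P = potential f α
    P′ = potential f α′
    R = + suc r′
    increment : P′ - P - 1ℤ ≡ sumOver S f - 1ℤ - R * f v
    increment = begin
      P′ - P - 1ℤ                              ≡⟨ shuffle P′ P R (f v) ⟩
      P′ + R * f v - P - 1ℤ - R * f v          ≡⟨ cong (λ x → x - P - 1ℤ - R * f v)
                                                       (potential-topple f v∈S r′≤αv α′≡) ⟩
      P + sumOver S f - P - 1ℤ - R * f v       ≡⟨ cancel P (sumOver S f) (R * f v) ⟩
      sumOver S f - 1ℤ - R * f v               ∎
      where
        shuffle : ∀ p′ p r x → p′ - p - 1ℤ ≡ p′ + r * x - p - 1ℤ - r * x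
        shuffle = solve-∀
        cancel : ∀ p s y → p + s - p - 1ℤ - y ≡ s - 1ℤ - y
        cancel = solve-∀

¬IsConfig-0 : ∀ {n} (α : Fin (suc n) → ℕ) → ¬ IsConfig 0 n α
¬IsConfig-0 {n} α total = nonnegative≢negative (trans total (negative (+ n)))
  where
    negative : ∀ x → (+ 0 - + 2) * (1ℤ + x) + 1ℤ ≡ - (1ℤ + x + x)
    negative = solve-∀
    nonnegative≢negative : ∀ {a b} → + a ≢ -[1+ b ]
    nonnegative≢negative ()

module Paths {n m} (E : Fin m → Subset (suc n)) where

  Path : Fin (suc n) → Fin (suc n) → Set
  Path = Star (Adjacent E)

  _∈ᵥ_ : ∀ {x y} → Fin (suc n) → Path x y → Set
  _∈ᵥ_ {x} w ε       = w ≡ x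
  _∈ᵥ_ {x} w (_ ◅ q) = w ≡ x ⊎ w ∈ᵥ q

  _∈ₑ_ : ∀ {x y} → Fin m → Path x y → Set
  j ∈ₑ ε              = ⊥
  j ∈ₑ ((j′ , _) ◅ q) = j ≡ j′ ⊎ j ∈ₑ q

  _∈ᵥ?_ : ∀ {x y} w (q : Path x y) → Dec (w ∈ᵥ q)
  _∈ᵥ?_ {x} w ε       = w ≟ x
  _∈ᵥ?_ {x} w (_ ◅ q) = (w ≟ x) ⊎-dec (w ∈ᵥ? q)

  _∈ₑ?_ : ∀ {x y} j (q : Path x y) → Dec (j ∈ₑ q)
  j ∈ₑ? ε              = no λ ()
  j ∈ₑ? ((j′ , _) ◅ q) = (j ≟ j′) ⊎-dec (j ∈ₑ? q)

  IsSimple : ∀ {x y} → Path x y → Set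
  IsSimple ε                        = ⊤
  IsSimple {x} ((j , _) ◅ q) = ¬ x ∈ᵥ q × ¬ j ∈ₑ q × IsSimple q

  SimplePath : Fin (suc n) → Fin (suc n) → Set
  SimplePath x y = Σ (Path x y) IsSimple

  suffixFrom : ∀ {x y z} (q : Path y z) → x ∈ᵥ q → IsSimple q → SimplePath x z
  suffixFrom ε                refl       _              = ε , tt
  suffixFrom (step ◅ q)       (inj₁ refl) simple        = step ◅ q , simple
  suffixFrom (_ ◅ q)          (inj₂ x∈q) (_ , _ , simple) = suffixFrom q x∈q simple

  enterAt : ∀ {x y z j} → x ∈ E j → (q : Path y z) → j ∈ₑ q → ¬ x ∈ᵥ q → IsSimple q →
            SimplePath x z
  enterAt x∈j ((j , _ , w∈j) ◅ q) (inj₁ refl) x∉ (_ , j∉q , simple) =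
    (j , x∈j , w∈j) ◅ q , x∉ ∘ inj₂ , j∉q , simple
  enterAt x∈j (_ ◅ q) (inj₂ j∈q) x∉ (_ , _ , simple) = enterAt x∈j q j∈q (x∉ ∘ inj₂) simple

  loopErase : ∀ {x y} → Path x y → SimplePath x y
  loopErase ε = ε , tt
  loopErase {x} ((j , x∈j , y∈j) ◅ q) with loopErase q
  ... | q′ , simple with x ∈ᵥ? q′
  ...   | yes x∈q′ = suffixFrom q′ x∈q′ simple
  ...   | no x∉q′ with j ∈ₑ? q′
  ...     | yes j∈q′ = enterAt x∈j q′ j∈q′ x∉q′ simple
  ...     | no j∉q′  = (j , x∈j , y∈j) ◅ q′ , x∉q′ , j∉q′ , simple

  length : ∀ {x y} → Path x y → ℕ
  length ε       = 0
  length (_ ◅ q) = suc (length q)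

  vertexAt : ∀ {x y} (q : Path x y) → Fin (suc (length q)) → Fin (suc n)
  vertexAt {x} ε       _       = x
  vertexAt {x} (_ ◅ q) zero    = x
  vertexAt     (_ ◅ q) (suc i) = vertexAt q i

  edgeAt : ∀ {x y} (q : Path x y) → Fin (length q) → Fin m
  edgeAt ((j , _) ◅ q) zero    = j
  edgeAt (_ ◅ q)       (suc i) = edgeAt q i

  vertexAt-∈ᵥ : ∀ {x y} (q : Path x y) i → vertexAt q i ∈ᵥ q
  vertexAt-∈ᵥ ε       zero    = refl
  vertexAt-∈ᵥ (_ ◅ q) zero    = inj₁ refl
  vertexAt-∈ᵥ (_ ◅ q) (suc i) = inj₂ (vertexAt-∈ᵥ q i)

  edgeAt-∈ₑ : ∀ {x y} (q : Path x y) i → edgeAt q i ∈ₑ q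
  edgeAt-∈ₑ (_ ◅ q) zero    = inj₁ refl
  edgeAt-∈ₑ (_ ◅ q) (suc i) = inj₂ (edgeAt-∈ₑ q i)

  vertexAt-injective : ∀ {x y} (q : Path x y) → IsSimple q → Injective (vertexAt q)
  vertexAt-injective ε       _                zero    zero    _  = refl
  vertexAt-injective (_ ◅ q) _                zero    zero    _  = refl
  vertexAt-injective (_ ◅ q) (x∉q , _)        zero    (suc j) eq = ⊥-elim (x∉q (subst (_∈ᵥ q) (sym eq) (vertexAt-∈ᵥ q j)))
  vertexAt-injective (_ ◅ q) (x∉q , _)        (suc i) zero    eq = ⊥-elim (x∉q (subst (_∈ᵥ q) eq (vertexAt-∈ᵥ q i)))
  vertexAt-injective (_ ◅ q) (_ , _ , simple) (suc i) (suc j) eq = cong suc (vertexAt-injective q simple i j eq)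

  edgeAt-injective : ∀ {x y} (q : Path x y) → IsSimple q → Injective (edgeAt q)
  edgeAt-injective (_ ◅ q) _                zero    zero    _  = refl
  edgeAt-injective (_ ◅ q) (_ , j∉q , _)    zero    (suc j) eq = ⊥-elim (j∉q (subst (_∈ₑ q) (sym eq) (edgeAt-∈ₑ q j)))
  edgeAt-injective (_ ◅ q) (_ , j∉q , _)    (suc i) zero    eq = ⊥-elim (j∉q (subst (_∈ₑ q) eq (edgeAt-∈ₑ q i)))
  edgeAt-injective (_ ◅ q) (_ , _ , simple) (suc i) (suc j) eq = cong suc (edgeAt-injective q simple i j eq)

  vertexAt-first : ∀ {x y} (q : Path x y) → vertexAt q zero ≡ x
  vertexAt-first ε       = refl
  vertexAt-first (_ ◅ q) = refl

  vertexAt-last : ∀ {x y} (q : Path x y) → vertexAt q (fromℕ (length q)) ≡ y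
  vertexAt-last ε       = refl
  vertexAt-last (_ ◅ q) = vertexAt-last q

  edgeAt-incident : ∀ {x y} (q : Path x y) i →
    vertexAt q (inject₁ i) ∈ E (edgeAt q i) × vertexAt q (suc i) ∈ E (edgeAt q i)
  edgeAt-incident ((j , x∈j , y∈j) ◅ q) zero = x∈j , subst (_∈ E j) (sym (vertexAt-first q)) y∈j
  edgeAt-incident (_ ◅ q) (suc i) = edgeAt-incident q i

Adjacent-sym : ∀ {n m} {E : Fin m → Subset (suc n)} {x y} → Adjacent E x y → Adjacent E y x
Adjacent-sym (j , x∈j , y∈j) = j , y∈j , x∈j

-- The cycle starts at b, so that e₀ is its first edge.
cycle-closedBy-e₀ : ∀ {n m} {E : Fin (suc m) → Subset (suc n)} {a b} → a ≢ b →
  a ∈ E zero → b ∈ E zero → Paths.SimplePath (E ∘ suc) a b → HCycle E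
cycle-closedBy-e₀ {E = E} {a} {b} a≢b a∈e₀ b∈e₀ (q , simple) =
  length q , positive q , rotate (vertexAt q) , zero Vector.∷ (suc ∘ edgeAt q) ,
  rotate-injective (vertexAt-injective q simple) ,
  ∷-injective-fresh (λ _ ()) (λ i j eq → edgeAt-injective q simple i j (suc-injective eq)) ,
  incident
  where
    open Paths (E ∘ suc)

    positive : (q : Path a b) → 1 ℕ.≤ length q
    positive ε       = ⊥-elim (a≢b refl)
    positive (_ ◅ _) = ℕ.s≤s ℕ.z≤n

    incident : ∀ i → let e = (zero Vector.∷ (suc ∘ edgeAt q)) i in
      rotate (vertexAt q) i ∈ E e × rotate (vertexAt q) (next i) ∈ E e
    incident zero =
      subst (_∈ E zero) (sym (vertexAt-last q)) b∈e₀ ,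
      subst (_∈ E zero) (sym (trans (rotate-next (vertexAt q) zero) (vertexAt-first q))) a∈e₀
    incident (suc i) =
      proj₁ (edgeAt-incident q i) ,
      subst (_∈ E (suc (edgeAt q i))) (sym (rotate-next (vertexAt q) (suc i))) (proj₂ (edgeAt-incident q i))

acyclic⇒¬Path-avoiding : ∀ {n m} {E : Fin (suc m) → Subset (suc n)} → ¬ HCycle E →
  ∀ {a b} → a ≢ b → a ∈ E zero → b ∈ E zero → ¬ Paths.Path (E ∘ suc) a b
acyclic⇒¬Path-avoiding {E = E} acyclic a≢b a∈e₀ b∈e₀ p =
  acyclic (cycle-closedBy-e₀ {E = E} a≢b a∈e₀ b∈e₀ (Paths.loopErase (E ∘ suc) p))

acyclic-tail : ∀ {n m} {E : Fin (suc m) → Subset (suc n)} → ¬ HCycle E → ¬ HCycle (E ∘ suc)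
acyclic-tail acyclic (k , k≥1 , v , e , v-inj , e-inj , incident) =
  acyclic (k , k≥1 , v , suc ∘ e , v-inj , (λ i j eq → e-inj i j (suc-injective eq)) , incident)

module _ {n m} (E : Fin (suc m) → Subset (suc n)) where
  open Paths

  Path-tail⇒Path : ∀ {x y} → Path (E ∘ suc) x y → Path E x y
  Path-tail⇒Path = gmap _ (λ { (j , x∈j , y∈j) → suc j , x∈j , y∈j })

  Path-split : ∀ {x y} → Path E x y →
    Path (E ∘ suc) x y ⊎ (∃[ a ] a ∈ E zero × Path (E ∘ suc) x a)
  Path-split ε                           = inj₁ ε
  Path-split {x} ((zero , x∈e₀ , _) ◅ _) = inj₂ (x , x∈e₀ , ε)
  Path-split ((suc j , x∈j , y∈j) ◅ p) with Path-split p
  ... | inj₁ q              = inj₁ ((j , x∈j , y∈j) ◅ q)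
  ... | inj₂ (a , a∈e₀ , q) = inj₂ (a , a∈e₀ , (j , x∈j , y∈j) ◅ q)

  -- Split the path at its first and at its last visit of e₀.
  Path⇒Path-tail⊎via-e₀ : ∀ {x y} → Path E x y →
    Path (E ∘ suc) x y ⊎
    ((∃[ a ] a ∈ E zero × Path (E ∘ suc) x a) × (∃[ b ] b ∈ E zero × Path (E ∘ suc) b y))
  Path⇒Path-tail⊎via-e₀ p with Path-split (reverse Adjacent-sym p)
  ... | inj₁ q = inj₁ (reverse Adjacent-sym q)
  ... | inj₂ (b , b∈e₀ , q) with Path-split p
  ...   | inj₁ p′    = inj₁ p′
  ...   | inj₂ via-a = inj₂ (via-a , b , b∈e₀ , reverse Adjacent-sym q)

reachable? : ∀ {n} m (E : Fin m → Subset (suc n)) → Decidable (Paths.Path E)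
reachable? zero E x y with x ≟ y
... | yes refl = yes ε
... | no x≢y   = no λ { ε → x≢y refl ; ((() , _) ◅ _) }
reachable? (suc m) E x y =
  map′ from (Path⇒Path-tail⊎via-e₀ E)
    (reachable? m F x y ⊎-dec
      (any? (λ a → (a ∈? E zero) ×-dec reachable? m F x a) ×-dec
       any? (λ b → (b ∈? E zero) ×-dec reachable? m F b y)))
  where
    F = E ∘ suc
    from : _ → Paths.Path E x y
    from (inj₁ p) = Path-tail⇒Path E p
    from (inj₂ ((a , a∈e₀ , p) , (b , b∈e₀ , q))) =
      Path-tail⇒Path E p ◅◅ (zero , a∈e₀ , b∈e₀) ◅ Path-tail⇒Path E q

uniform-acyclic-weight : ∀ {n r′} m (E : Fin m → Subset (suc n)) →
  (∀ j → ∣ E j ∣ ≡ suc r′) → ¬ HCycle E →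
  ∃[ f ] ∀ j → + suc r′ ∣ℤ sumOver (E j) f - 1ℤ
uniform-acyclic-weight zero E _ _ = (λ _ → 0ℤ) , λ ()
uniform-acyclic-weight {n} {r′} (suc m) E uniform acyclic = f , edge-sum
  where
    open Paths using (Path)
    F = E ∘ suc
    R = + suc r′

    weightF = uniform-acyclic-weight m F (uniform ∘ suc) (acyclic-tail {E = E} acyclic)
    f′ = proj₁ weightF

    u = proj₁ (size-suc⇒Nonempty (E zero) (uniform zero))
    u∈e₀ = proj₂ (size-suc⇒Nonempty (E zero) (uniform zero))

    d : ℤ
    d = 1ℤ - sumOver (E zero) f′

    shift : Fin (suc n) → ℤ
    shift w = if does (reachable? m F u w) then d else 0ℤ

    f : Fin (suc n) → ℤ
    f w = f′ w + shift w

    shift-reachable : ∀ {w} → Path F u w → shift w ≡ d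
    shift-reachable u⇝w = cong (if_then d else 0ℤ) (dec-true (reachable? m F u _) u⇝w)

    shift-unreachable : ∀ {w} → ¬ Path F u w → shift w ≡ 0ℤ
    shift-unreachable ¬u⇝w = cong (if_then d else 0ℤ) (dec-false (reachable? m F u _) ¬u⇝w)

    shift-e₀ : sumOver (E zero) shift ≡ d
    shift-e₀ = trans (sumOver-supportedAt (E zero) shift u∈e₀ (λ w∈e₀ w≢u →
                        shift-unreachable (acyclic⇒¬Path-avoiding {E = E} acyclic (w≢u ∘ sym) u∈e₀ w∈e₀)))
                     (shift-reachable ε)

    shift-constantOn : ∀ j → ∃[ c ] ∀ {w} → w ∈ F j → shift w ≡ c
    shift-constantOn j with size-suc⇒Nonempty (F j) (uniform (suc j))
    ... | w₀ , w₀∈j with reachable? m F u w₀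
    ...   | yes u⇝w₀ = d , λ w∈j → shift-reachable (u⇝w₀ ◅◅ (j , w₀∈j , w∈j) ◅ ε)
    ...   | no ¬u⇝w₀ = 0ℤ , λ w∈j → shift-unreachable (λ u⇝w → ¬u⇝w₀ (u⇝w ◅◅ (j , w∈j , w₀∈j) ◅ ε))

    R∣shift : ∀ j → R ∣ℤ sumOver (F j) shift
    R∣shift j with shift-constantOn j
    ... | c , constant = divides c (trans (sumOver-constantOn (F j) constant)
                                          (cong (λ s → c * + s) (uniform (suc j))))

    edge-sum : ∀ j → R ∣ℤ sumOver (E j) f - 1ℤ
    edge-sum zero = divides 0ℤ (begin
      sumOver (E zero) f - 1ℤ
        ≡⟨ cong (_- 1ℤ) (sumOver-+ (E zero) f′ shift) ⟩
      sumOver (E zero) f′ + sumOver (E zero) shift - 1ℤ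
        ≡⟨ cong (λ s → sumOver (E zero) f′ + s - 1ℤ) shift-e₀ ⟩
      sumOver (E zero) f′ + d - 1ℤ
        ≡⟨ cancel (sumOver (E zero) f′) ⟩
      0ℤ ∎)
      where
        cancel : ∀ s → s + (1ℤ - s) - 1ℤ ≡ 0ℤ
        cancel = solve-∀
    edge-sum (suc j) =
      subst (R ∣ℤ_) (sym regroup) (∣m∣n⇒∣m+n (proj₂ weightF j) (R∣shift j))
      where
        regroup : sumOver (F j) f - 1ℤ ≡ sumOver (F j) f′ - 1ℤ + sumOver (F j) shift
        regroup = trans (cong (_- 1ℤ) (sumOver-+ (F j) f′ shift))
                        (swap (sumOver (F j) f′) (sumOver (F j) shift))
          where
            swap : ∀ a b → a + b - 1ℤ ≡ a - 1ℤ + b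
            swap = solve-∀

mainTheorem8 : (r n m : ℕ) (E : Fin m → Subset (suc n)) → IsTree r n m E →
    (_≻_ : Fin (suc n) → Fin (suc n) → Set) → IsStrictTotalOrder _≡_ _≻_ →
    (k : ℕ) → DirectedCycle r E _≻_ k → r ∣ suc k
mainTheorem8 zero n m E _ _≻_ _ k (c , _ , arcs) = ⊥-elim (¬IsConfig-0 (c zero) (proj₁ (arcs zero)))
mainTheorem8 (suc r′) n m E ((uniform , _) , _ , acyclic) _≻_ _ k (c , _ , arcs) =
  ∣⇒∣ᵤ (cycle-length-divisible (λ i → potential f (c i)) increment)
  where
    weight = uniform-acyclic-weight m E uniform acyclic
    f = proj₁ weight

    increment : ∀ i → + suc r′ ∣ℤ potential f (c (next i)) - potential f (c i) - 1ℤ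
    increment i with arcs i
    ... | _ , _ , v , j , v∈j , (r′≤cᵢv , _) , toppled =
      potential-topple-increment {f = f} (proj₂ weight j) v∈j r′≤cᵢv toppled
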